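{- For every $r\ge0$ and every $\alpha\in\mathbb{Z}^m$, \[ F_r^\perp\,\mathfrak{S}_\alpha = \sum_{\substack{\beta\in\mathbb{Z}^m\\ i-m\le\beta_i\le\alpha_i\ \forall i\\ |\beta|=|\alpha|-r}} \mathfrak{S}_\beta. \]
   Context: Work over $\mathbb{Q}$. $\mathrm{NSym}$ is the free associative algebra on $H_1,H_2,\dots$ ($H_0=1$, $H_{ -r}=0$ for $r>0$), graded dual to $\mathrm{QSym}$ via $\langle H_{\alpha_1}\cdots H_{\alpha_k},M_\beta\rangle=\delta_{\alpha\beta}$ ($M_\beta$ monomial quasisymmetric functions), coproduct $\Delta(H_j)=\sum_iH_i\otimes H_{j-i}$. For $F\in\mathrm{QSym}$, $F^\perp$ satisfies $\langle F^\perp(H),G\rangle=\langle H,FG\rangle$. $F_r=\sum_{\gamma\models r}M_\gamma$ is the fundamental quasisymmetric function indexed by the one-part composition $(r)$ ($F_0=1$), and $F_{1^i}=M_{1^i}$. Let $\mathbb{B}_m=\sum_{i\ge0}(-1)^iH_{m+i}F_{1^i}^\perp$ for $m\in\mathbb{Z}$ and for $\alpha\in\mathbb{Z}^m$, $\mathfrak{S}_\alpha=\mathbb{B}_{\alpha_1}\cdots\mathbb{B}_{\alpha_m}(1)$. $|\beta|$ is the sum of the entries of $\beta$. -}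

module Defs where

open import Data.Nat as ℕ using (ℕ; zero; suc; _∸_)
open import Data.Integer as ℤ using (ℤ; +_; -[1+_])
open import Data.Rational as ℚ using (ℚ; 0ℚ; 1ℚ)
open import Data.List using (List; []; _∷_; _++_; map; concat; concatMap; upTo; replicate; filter)
open import Data.Nat.ListAction using (sum)
open import Data.List.Properties using (≡-dec)
open import Data.Vec as Vec using (Vec)
open import Data.Fin using (Fin; toℕ)
open import Data.Bool using (Bool; true; false; if_then_else_; _∧_; not)
open import Data.Product using (_×_; _,_; proj₁; proj₂)
open import Relation.Nullary.Decidable using (does)
open import Relation.Binary.PropositionalEquality using (_≡_)

-- An element is a finite formal ℚ-linear combination of
-- words H_{α₁}⋯H_{αₖ} (α a list of naturals).  Since H_0 = 1, a word is
-- identified with the composition obtained by deleting zero entries.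

dropZeros : List ℕ → List ℕ
dropZeros []          = []
dropZeros (zero ∷ α)  = dropZeros α
dropZeros (suc n ∷ α) = suc n ∷ dropZeros α

NSym : Set
NSym = List (ℚ × List ℕ)

coeff : NSym → List ℕ → ℚ
coeff []             γ = 0ℚ
coeff ((c , α) ∷ x) γ =
  (if does (≡-dec ℕ._≟_ (dropZeros α) γ) then c else 0ℚ) ℚ.+ coeff x γ

infix 4 _≈_
_≈_ : NSym → NSym → Set
x ≈ y = ∀ γ → coeff x γ ≡ coeff y γ

oneN : NSym
oneN = (1ℚ , []) ∷ []

scale : ℚ → NSym → NSym
scale c = map (λ p → (c ℚ.* proj₁ p , proj₂ p))

sumN : List NSym → NSym
sumN = concat

-- left multiplication by H_k, k ∈ ℤ  (H_0 = 1, H_k = 0 for k < 0)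
hMul : ℤ → NSym → NSym
hMul (+ k)    x = map (λ p → (proj₁ p , k ∷ proj₂ p)) x
hMul -[1+ _ ] x = []

-- QSym elements, given by their coefficients in the monomial basis M_γ.

QSymM : Set
QSymM = List ℕ → ℚ

positive : ℕ → Bool
positive zero    = false
positive (suc _) = true

allPositive : List ℕ → Bool
allPositive []      = true
allPositive (n ∷ γ) = positive n ∧ allPositive γ

Fr : ℕ → QSymM
Fr r γ = if allPositive γ ∧ does (sum γ ℕ.≟ r) then 1ℚ else 0ℚ

F1 : ℕ → QSymM
F1 i γ = if does (≡-dec ℕ._≟_ γ (replicate i 1)) then 1ℚ else 0ℚ

-- Coproduct of H_α: all componentwise splittings α = a + b.
splits : List ℕ → List (List ℕ × List ℕ)
splits []      = ([] , []) ∷ []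
splits (n ∷ α) =
  concatMap (λ a → map (λ p → (a ∷ proj₁ p , (n ∸ a) ∷ proj₂ p)) (splits α))
            (upTo (suc n))

-- F^⊥ h = Σ ⟨h₍₁₎, F⟩ h₍₂₎  (adjoint of multiplication by F), where
-- Δ(H_α) = Σ_{a+b=α} H_a ⊗ H_b and ⟨H_γ, F⟩ = M_γ-coefficient of F.
perp : QSymM → NSym → NSym
perp F = concatMap (λ t → map (λ ab → (proj₁ t ℚ.* F (dropZeros (proj₁ ab)) , proj₂ ab))
                                (splits (proj₂ t)))

sgn : ℕ → ℚ
sgn zero    = 1ℚ
sgn (suc i) = ℚ.- sgn i

-- total degree bound of an element (sum of all word weights);
-- F_{1^i}^⊥ kills every H_α with |α| < i, so the sum over i is finite.
weight : NSym → ℕ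
weight x = sum (map (λ p → sum (proj₂ p)) x)

-- 𝔹_m = Σ_{i ≥ 0} (-1)^i H_{m+i} F_{1^i}^⊥   (terms with i > weight vanish)
𝔹 : ℤ → NSym → NSym
𝔹 m x = sumN (map (λ i → scale (sgn i) (hMul (m ℤ.+ + i) (perp (F1 i) x)))
                  (upTo (suc (weight x))))

𝔖 : {m : ℕ} → Vec ℤ m → NSym
𝔖 α = Vec.foldr _ 𝔹 oneN α

rangeℤ : ℤ → ℤ → List ℤ
rangeℤ lo hi with hi ℤ.- lo
... | + n      = map (λ k → lo ℤ.+ + k) (upTo (suc n))
... | -[1+ _ ] = []

boxList : {m : ℕ} → Vec (ℤ × ℤ) m → List (Vec ℤ m)
boxList Vec.[]             = Vec.[] ∷ []
boxList ((lo , hi) Vec.∷ bs) =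
  concatMap (λ b → map (b Vec.∷_) (boxList bs)) (rangeℤ lo hi)

-- the box { β | i - m ≤ β_i ≤ α_i } (i 1-indexed, i.e. toℕ i + 1)
box : {m : ℕ} → Vec ℤ m → List (Vec ℤ m)
box {m} α = boxList (Vec.tabulate (λ (i : Fin m) →
  (+ suc (toℕ i) ℤ.- + m , Vec.lookup α i)))

sumℤ : {m : ℕ} → Vec ℤ m → ℤ
sumℤ = Vec.foldr _ ℤ._+_ (+ 0)

-- Pair both sides with an arbitrary G ∈ QSym.  F_r^⊥ is adjoint to multiplication by F_r, and 𝔹_m has
-- the adjoint 𝔹ᵀ_m = Σ_i (-1)^i F_{1^i} · H_{m+i}^⊥, so the claim becomes ⟨𝔖_α, F_r G⟩ = Σ_β ⟨𝔖_β, G⟩,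
-- proved by induction on α.  The Leibniz rule H_k^⊥(F_r G) = Σ_j F_{r-j} H_{k-j}^⊥ G gives the commutation
-- 𝔹ᵀ_a(F_r G) = Σ_{j ≤ r} F_{r-j} 𝔹ᵀ_{a-j} G, so the first entry of β is a - j.  It cannot drop below
-- 1 - m because 𝔖_(b,γ) = 0 whenever b + length γ < 0: in 𝔹_b 𝔖_γ = Σ_i (-1)^i H_{b+i} F_{1^i}^⊥ 𝔖_γ the
-- terms with i ≤ length γ have H_{b+i} = 0, and the others vanish since F_{1^i}^⊥ 𝔖_γ = 0 for i > length γ,
-- which follows by induction from F_{1^{j+1}}^⊥ 𝔹_m = 𝔹_m F_{1^{j+1}}^⊥ + 𝔹_{m-1} F_{1^j}^⊥.

module Submission where

open import Defs
open import Algebra.Bundles using (CommutativeMonoid)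
import Algebra.Properties.CommutativeSemigroup as CommutativeSemigroupProperties
open import Data.Bool using (Bool; true; false; if_then_else_)
open import Data.Fin using (toℕ)
open import Data.Integer as ℤ using (ℤ; +_; -[1+_])
import Data.Integer.Properties as ℤₚ
open import Data.Integer.Tactic.RingSolver using () renaming (solve-∀ to ℤ-solve-∀)
open import Data.List using (List; []; _∷_; _++_; map; concat; concatMap; upTo; applyUpTo; replicate; filter)
open import Data.List.Properties using (≡-dec; ∷-injectiveʳ)
open import Data.Nat as ℕ using (ℕ; zero; suc; _∸_; _≤_; _<_; z≤n; s≤s)
open import Data.Nat.ListAction using (sum)
import Data.Nat.Properties as ℕₚ
open import Data.Product using (_×_; _,_; proj₁; proj₂)
open import Data.Rational as ℚ using (ℚ; 0ℚ; 1ℚ; _+_; _*_)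
import Data.Rational.Properties as ℚₚ
open import Data.Sum using (inj₁; inj₂)
open import Data.Vec as Vec using (Vec; _∷_)
open import Data.Vec.Properties using (tabulate-cong; tabulate-∘; tabulate∘lookup)
open import Function using (_∘_; id)
open import Function.Bundles using (_⇔_; mk⇔)
open import Relation.Binary.PropositionalEquality
open import Relation.Nullary using (Dec; yes; no)
open import Relation.Nullary.Decidable using (does; dec-true; dec-false; does-⇔; dec⇒maybe)
open import Tactic.RingSolver using (solve-∀)
open import Tactic.RingSolver.Core.AlmostCommutativeRing using (AlmostCommutativeRing; fromCommutativeRing)

open CommutativeSemigroupProperties (CommutativeMonoid.commutativeSemigroup ℚₚ.+-0-commutativeMonoid)
  using () renaming (interchange to +-interchange)
open CommutativeSemigroupProperties (CommutativeMonoid.commutativeSemigroup ℚₚ.*-1-commutativeMonoid)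
  using () renaming (x∙yz≈y∙xz to x*[y*z]≡y*[x*z])
open CommutativeSemigroupProperties ℕₚ.+-commutativeSemigroup
  using () renaming (interchange to ℕ-+-interchange)

private
  variable
    A B : Set

ℚ-ring : AlmostCommutativeRing _ _
ℚ-ring = fromCommutativeRing ℚₚ.+-*-commutativeRing (λ x → dec⇒maybe (0ℚ ℚₚ.≟ x))

∑ : List A → (A → ℚ) → ℚ
∑ []       f = 0ℚ
∑ (x ∷ xs) f = f x + ∑ xs f

∑< : ℕ → (ℕ → ℚ) → ℚ
∑< zero    f = 0ℚ
∑< (suc n) f = f 0 + ∑< n (f ∘ suc)

∑-cong : (xs : List A) {f g : A → ℚ} → (∀ x → f x ≡ g x) → ∑ xs f ≡ ∑ xs g
∑-cong []       e = refl
∑-cong (x ∷ xs) e = cong₂ _+_ (e x) (∑-cong xs e)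

∑-zero : (xs : List A) {f : A → ℚ} → (∀ x → f x ≡ 0ℚ) → ∑ xs f ≡ 0ℚ
∑-zero []       e = refl
∑-zero (x ∷ xs) e = trans (cong₂ _+_ (e x) (∑-zero xs e)) (ℚₚ.+-identityˡ 0ℚ)

∑-++ : (xs ys : List A) (f : A → ℚ) → ∑ (xs ++ ys) f ≡ ∑ xs f + ∑ ys f
∑-++ []       ys f = sym (ℚₚ.+-identityˡ _)
∑-++ (x ∷ xs) ys f = trans (cong (_+_ (f x)) (∑-++ xs ys f)) (sym (ℚₚ.+-assoc (f x) _ _))

∑-concat : (xss : List (List A)) (f : A → ℚ) → ∑ (concat xss) f ≡ ∑ xss (λ xs → ∑ xs f)
∑-concat []         f = refl
∑-concat (xs ∷ xss) f = trans (∑-++ xs (concat xss) f) (cong (_+_ (∑ xs f)) (∑-concat xss f))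

∑-map : (h : A → B) (xs : List A) (f : B → ℚ) → ∑ (map h xs) f ≡ ∑ xs (f ∘ h)
∑-map h []       f = refl
∑-map h (x ∷ xs) f = cong (_+_ (f (h x))) (∑-map h xs f)

∑-concatMap : (h : A → List B) (xs : List A) (f : B → ℚ) →
              ∑ (concatMap h xs) f ≡ ∑ xs (λ x → ∑ (h x) f)
∑-concatMap h xs f = trans (∑-concat (map h xs) f) (∑-map h xs (λ ys → ∑ ys f))

∑-+ : (xs : List A) (f g : A → ℚ) → ∑ xs (λ x → f x + g x) ≡ ∑ xs f + ∑ xs g
∑-+ []       f g = refl
∑-+ (x ∷ xs) f g = trans (cong (_+_ (f x + g x)) (∑-+ xs f g)) (+-interchange (f x) (g x) _ _)

*-distribˡ-∑ : (xs : List A) (c : ℚ) (f : A → ℚ) → c * ∑ xs f ≡ ∑ xs (λ x → c * f x)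
*-distribˡ-∑ []       c f = ℚₚ.*-zeroʳ c
*-distribˡ-∑ (x ∷ xs) c f = trans (ℚₚ.*-distribˡ-+ c (f x) _) (cong (_+_ (c * f x)) (*-distribˡ-∑ xs c f))

∑-filter : {P : A → Set} (P? : ∀ x → Dec (P x)) (xs : List A) (f : A → ℚ) →
           ∑ (filter P? xs) f ≡ ∑ xs (λ x → if does (P? x) then f x else 0ℚ)
∑-filter P? []       f = refl
∑-filter P? (x ∷ xs) f with does (P? x)
... | true  = cong (_+_ (f x)) (∑-filter P? xs f)
... | false = trans (∑-filter P? xs f) (sym (ℚₚ.+-identityˡ _))

∑-applyUpTo : ∀ n (h : ℕ → ℕ) (f : ℕ → ℚ) → ∑ (applyUpTo h n) f ≡ ∑< n (f ∘ h)
∑-applyUpTo zero    h f = refl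
∑-applyUpTo (suc n) h f = cong (_+_ (f (h 0))) (∑-applyUpTo n (h ∘ suc) f)

∑-upTo : ∀ n (f : ℕ → ℚ) → ∑ (upTo n) f ≡ ∑< n f
∑-upTo n = ∑-applyUpTo n id

∑<-cong : ∀ n {f g : ℕ → ℚ} → (∀ k → k < n → f k ≡ g k) → ∑< n f ≡ ∑< n g
∑<-cong zero    e = refl
∑<-cong (suc n) e = cong₂ _+_ (e 0 (s≤s z≤n)) (∑<-cong n (λ k k<n → e (suc k) (s≤s k<n)))

∑<-zero : ∀ n {f : ℕ → ℚ} → (∀ k → k < n → f k ≡ 0ℚ) → ∑< n f ≡ 0ℚ
∑<-zero zero    e = refl
∑<-zero (suc n) e =
  trans (cong₂ _+_ (e 0 (s≤s z≤n)) (∑<-zero n (λ k k<n → e (suc k) (s≤s k<n)))) (ℚₚ.+-identityˡ 0ℚ)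

∑<-+ : ∀ n (f g : ℕ → ℚ) → ∑< n (λ k → f k + g k) ≡ ∑< n f + ∑< n g
∑<-+ zero    f g = refl
∑<-+ (suc n) f g = trans (cong (_+_ (f 0 + g 0)) (∑<-+ n _ _)) (+-interchange (f 0) (g 0) _ _)

*-distribˡ-∑< : ∀ n (c : ℚ) (f : ℕ → ℚ) → c * ∑< n f ≡ ∑< n (λ k → c * f k)
*-distribˡ-∑< zero    c f = ℚₚ.*-zeroʳ c
*-distribˡ-∑< (suc n) c f = trans (ℚₚ.*-distribˡ-+ c (f 0) _) (cong (_+_ (c * f 0)) (*-distribˡ-∑< n c _))

∑-∑< : (xs : List A) (n : ℕ) (f : A → ℕ → ℚ) →
       ∑ xs (λ x → ∑< n (f x)) ≡ ∑< n (λ k → ∑ xs (λ x → f x k))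
∑-∑< []       n f = sym (∑<-zero n (λ _ _ → refl))
∑-∑< (x ∷ xs) n f = trans (cong (_+_ (∑< n (f x))) (∑-∑< xs n f)) (sym (∑<-+ n (f x) _))

∑<-swap : ∀ n m (f : ℕ → ℕ → ℚ) → ∑< n (λ i → ∑< m (f i)) ≡ ∑< m (λ j → ∑< n (λ i → f i j))
∑<-swap zero    m f = sym (∑<-zero m (λ _ _ → refl))
∑<-swap (suc n) m f = trans (cong (_+_ (∑< m (f 0))) (∑<-swap n m _)) (sym (∑<-+ m (f 0) _))

∑<-snoc : ∀ n (f : ℕ → ℚ) → ∑< (suc n) f ≡ ∑< n f + f n
∑<-snoc zero    f = trans (ℚₚ.+-identityʳ (f 0)) (sym (ℚₚ.+-identityˡ (f 0)))
∑<-snoc (suc n) f = trans (cong (_+_ (f 0)) (∑<-snoc n (f ∘ suc))) (sym (ℚₚ.+-assoc (f 0) _ _))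

∑<-reverse : ∀ n (f : ℕ → ℚ) → ∑< n f ≡ ∑< n (λ k → f (n ∸ suc k))
∑<-reverse zero    f = refl
∑<-reverse (suc n) f =
  trans (∑<-snoc n f) (trans (cong (_+ f n) (∑<-reverse n f)) (ℚₚ.+-comm _ (f n)))

∑<-truncate : ∀ {q p} (f : ℕ → ℚ) → q ≤ p → (∀ k → q ≤ k → k < p → f k ≡ 0ℚ) → ∑< p f ≡ ∑< q f
∑<-truncate {zero}          f z≤n       e = ∑<-zero _ (λ k → e k z≤n)
∑<-truncate {suc q} {suc p} f (s≤s q≤p) e =
  cong (_+_ (f 0)) (∑<-truncate (f ∘ suc) q≤p (λ k q≤k k<p → e (suc k) (s≤s q≤k) (s≤s k<p)))

∑<-match : ∀ p q (f g : ℕ → ℚ) → (∀ k → k < p → k < q → f k ≡ g k) →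
           (∀ k → q ≤ k → k < p → f k ≡ 0ℚ) → (∀ k → p ≤ k → k < q → g k ≡ 0ℚ) →
           ∑< p f ≡ ∑< q g
∑<-match p q f g e f≡0 g≡0 with ℕₚ.≤-total p q
... | inj₁ p≤q = trans (∑<-cong p (λ k k<p → e k k<p (ℕₚ.<-≤-trans k<p p≤q)))
                       (sym (∑<-truncate g p≤q g≡0))
... | inj₂ q≤p = trans (∑<-truncate f q≤p f≡0)
                       (∑<-cong q (λ k k<q → e k (ℕₚ.<-≤-trans k<q q≤p) k<q))

∑<-triangle : ∀ n (T : ℕ → ℕ → ℚ) →
              ∑< (suc n) (λ a → ∑< (suc (n ∸ a)) (T a)) ≡ ∑< (suc n) (λ c → ∑< (suc (n ∸ c)) (λ a → T a c))
∑<-triangle n T = begin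
    ∑< (suc n) (λ a → ∑< (suc (n ∸ a)) (T a))
  ≡⟨ ∑<-cong (suc n) (λ a a≤n → ∑<-under (ℕₚ.≤-pred a≤n) (T a)) ⟩
    ∑< (suc n) (λ a → ∑< (suc n) (λ c → [ c ℕ.+ a ≤n] (T a c)))
  ≡⟨ ∑<-swap (suc n) (suc n) (λ a c → [ c ℕ.+ a ≤n] (T a c)) ⟩
    ∑< (suc n) (λ c → ∑< (suc n) (λ a → [ c ℕ.+ a ≤n] (T a c)))
  ≡⟨ ∑<-cong (suc n) (λ c _ → ∑<-cong (suc n) (λ a _ →
       cong (λ s → [ s ≤n] (T a c)) (ℕₚ.+-comm c a))) ⟩
    ∑< (suc n) (λ c → ∑< (suc n) (λ a → [ a ℕ.+ c ≤n] (T a c)))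
  ≡⟨ ∑<-cong (suc n) (λ c c≤n → ∑<-under (ℕₚ.≤-pred c≤n) (λ a → T a c)) ⟨
    ∑< (suc n) (λ c → ∑< (suc (n ∸ c)) (λ a → T a c)) ∎
  where
    open ≡-Reasoning
    [_≤n] : ℕ → ℚ → ℚ
    [ s ≤n] x = if does (s ℕ.≤? n) then x else 0ℚ
    ∑<-under : ∀ {a} → a ≤ n → (f : ℕ → ℚ) →
               ∑< (suc (n ∸ a)) f ≡ ∑< (suc n) (λ c → [ c ℕ.+ a ≤n] (f c))
    ∑<-under {a} a≤n f = sym (trans
      (∑<-truncate _ (s≤s (ℕₚ.m∸n≤m n a)) (λ c n∸a<c _ → cong (λ b → if b then f c else 0ℚ)
        (dec-false (c ℕ.+ a ℕ.≤? n) (λ c+a≤n → ℕₚ.<⇒≱ n∸a<c (ℕₚ.m+n≤o⇒m≤o∸n c c+a≤n)))))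
      (∑<-cong (suc (n ∸ a)) (λ c c≤n∸a → cong (λ b → if b then f c else 0ℚ)
        (dec-true (c ℕ.+ a ℕ.≤? n) (ℕₚ.m≤o∸n⇒m+n≤o c a≤n (ℕₚ.≤-pred c≤n∸a))))))

𝟙 : Bool → ℚ
𝟙 b = if b then 1ℚ else 0ℚ

if-zero : ∀ b {x} → x ≡ 0ℚ → (if b then x else 0ℚ) ≡ 0ℚ
if-zero true  x≡0 = x≡0
if-zero false _   = refl

sum-replicate-1 : ∀ i → sum (replicate i 1) ≡ i
sum-replicate-1 zero    = refl
sum-replicate-1 (suc i) = cong suc (sum-replicate-1 i)

dropZeros-idem : ∀ w → dropZeros (dropZeros w) ≡ dropZeros w
dropZeros-idem []          = refl
dropZeros-idem (zero ∷ w)  = dropZeros-idem w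
dropZeros-idem (suc n ∷ w) = cong (suc n ∷_) (dropZeros-idem w)

dropZeros-∷ : ∀ k w → dropZeros (k ∷ dropZeros w) ≡ dropZeros (k ∷ w)
dropZeros-∷ zero    w = dropZeros-idem w
dropZeros-∷ (suc k) w = cong (suc k ∷_) (dropZeros-idem w)

sum-dropZeros : ∀ w → sum (dropZeros w) ≡ sum w
sum-dropZeros []          = refl
sum-dropZeros (zero ∷ w)  = sum-dropZeros w
sum-dropZeros (suc n ∷ w) = cong (suc n ℕ.+_) (sum-dropZeros w)

allPositive-dropZeros : ∀ w → allPositive (dropZeros w) ≡ true
allPositive-dropZeros []          = refl
allPositive-dropZeros (zero ∷ w)  = allPositive-dropZeros w
allPositive-dropZeros (suc n ∷ w) = allPositive-dropZeros w

-- QSym, its product and the operators H_k^⊥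

-- Elements of QSym are only ever evaluated at compositions, so they are compared there.
infix 4 _≐_
record _≐_ (F G : QSymM) : Set where
  constructor pointwise
  field at : ∀ u → F (dropZeros u) ≡ G (dropZeros u)
open _≐_

≐-refl : ∀ {F} → F ≐ F
≐-refl = pointwise (λ _ → refl)

≐-reflexive : ∀ {F G} → F ≡ G → F ≐ G
≐-reflexive refl = ≐-refl

≐-sym : ∀ {F G} → F ≐ G → G ≐ F
≐-sym F≐G = pointwise (λ u → sym (at F≐G u))

0Q : QSymM
0Q _ = 0ℚ

-- The product of QSym: its value at δ is ⟨Δ H_δ, F ⊗ G⟩.
infixl 7 _∙_
_∙_ : QSymM → QSymM → QSymM
(F ∙ G) δ = ∑ (splits δ) (λ ab → F (dropZeros (proj₁ ab)) * G (dropZeros (proj₂ ab)))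

-- H_k^⊥ on QSym, the adjoint of left multiplication by H_k on NSym.
H⊥ : ℤ → QSymM → QSymM
H⊥ (+ k)    G u = G (dropZeros (k ∷ u))
H⊥ -[1+ _ ] G u = 0ℚ

H⊥-zero : ∀ G → H⊥ (+ 0) G ≐ G
H⊥-zero G = pointwise (λ u → cong G (dropZeros-idem u))

∙-∷ : ∀ n δ F G → (F ∙ G) (n ∷ δ) ≡ ∑< (suc n) (λ a → (H⊥ (+ a) F ∙ H⊥ (+ (n ∸ a)) G) δ)
∙-∷ n δ F G = begin
    (F ∙ G) (n ∷ δ)
  ≡⟨ ∑-concatMap (λ a → map (split a) (splits δ)) (upTo (suc n)) _ ⟩
    ∑ (upTo (suc n)) (λ a → ∑ (map (split a) (splits δ)) term)
  ≡⟨ ∑-cong (upTo (suc n)) (λ a → trans (∑-map (split a) (splits δ) term)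
       (∑-cong (splits δ) (λ ab → cong₂ _*_ (cong F (sym (dropZeros-∷ a (proj₁ ab))))
                                           (cong G (sym (dropZeros-∷ (n ∸ a) (proj₂ ab))))))) ⟩
    ∑ (upTo (suc n)) (λ a → (H⊥ (+ a) F ∙ H⊥ (+ (n ∸ a)) G) δ)
  ≡⟨ ∑-upTo (suc n) (λ a → (H⊥ (+ a) F ∙ H⊥ (+ (n ∸ a)) G) δ) ⟩
    ∑< (suc n) (λ a → (H⊥ (+ a) F ∙ H⊥ (+ (n ∸ a)) G) δ) ∎
  where
    open ≡-Reasoning
    split : ℕ → List ℕ × List ℕ → List ℕ × List ℕ
    split a ab = (a ∷ proj₁ ab , (n ∸ a) ∷ proj₂ ab)
    term : List ℕ × List ℕ → ℚ
    term ab = F (dropZeros (proj₁ ab)) * G (dropZeros (proj₂ ab))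

∙-cong : ∀ {F F' G G'} → F ≐ F' → G ≐ G' → ∀ δ → (F ∙ G) δ ≡ (F' ∙ G') δ
∙-cong F≐F' G≐G' δ = ∑-cong (splits δ) (λ ab → cong₂ _*_ (at F≐F' (proj₁ ab)) (at G≐G' (proj₂ ab)))

∙-congˡ : ∀ {F F'} → F ≐ F' → ∀ G δ → (F ∙ G) δ ≡ (F' ∙ G) δ
∙-congˡ F≐F' G = ∙-cong F≐F' (≐-refl {G})

∙-congʳ : ∀ F {G G'} → G ≐ G' → ∀ δ → (F ∙ G) δ ≡ (F ∙ G') δ
∙-congʳ F = ∙-cong (≐-refl {F})

∙-dropZeros : ∀ w F G → (F ∙ G) (dropZeros w) ≡ (F ∙ G) w
∙-dropZeros []          F G = refl
∙-dropZeros (zero ∷ w)  F G = begin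
    (F ∙ G) (dropZeros w)
  ≡⟨ ∙-dropZeros w F G ⟩
    (F ∙ G) w
  ≡⟨ ∙-cong (≐-sym (H⊥-zero F)) (≐-sym (H⊥-zero G)) w ⟩
    (H⊥ (+ 0) F ∙ H⊥ (+ 0) G) w
  ≡⟨ ℚₚ.+-identityʳ _ ⟨
    ∑< 1 (λ a → (H⊥ (+ a) F ∙ H⊥ (+ (0 ∸ a)) G) w)
  ≡⟨ ∙-∷ 0 w F G ⟨
    (F ∙ G) (0 ∷ w) ∎
  where open ≡-Reasoning
∙-dropZeros (suc n ∷ w) F G = begin
    (F ∙ G) (suc n ∷ dropZeros w)
  ≡⟨ ∙-∷ (suc n) (dropZeros w) F G ⟩
    ∑< (suc (suc n)) (λ a → (H⊥ (+ a) F ∙ H⊥ (+ (suc n ∸ a)) G) (dropZeros w))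
  ≡⟨ ∑<-cong (suc (suc n)) (λ a _ → ∙-dropZeros w (H⊥ (+ a) F) (H⊥ (+ (suc n ∸ a)) G)) ⟩
    ∑< (suc (suc n)) (λ a → (H⊥ (+ a) F ∙ H⊥ (+ (suc n ∸ a)) G) w)
  ≡⟨ ∙-∷ (suc n) w F G ⟨
    (F ∙ G) (suc n ∷ w) ∎
  where open ≡-Reasoning

H⊥-∙ : ∀ n F G u → H⊥ (+ n) (F ∙ G) u ≡ ∑< (suc n) (λ a → (H⊥ (+ a) F ∙ H⊥ (+ (n ∸ a)) G) u)
H⊥-∙ n F G u = trans (∙-dropZeros (n ∷ u) F G) (∙-∷ n u F G)

∙-∑<ʳ : ∀ F n (G : ℕ → QSymM) δ → (F ∙ (λ u → ∑< n (λ k → G k u))) δ ≡ ∑< n (λ k → (F ∙ G k) δ)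
∙-∑<ʳ F n G δ =
  trans (∑-cong (splits δ) (λ ab → *-distribˡ-∑< n (F (dropZeros (proj₁ ab))) (λ k → G k (dropZeros (proj₂ ab)))))
        (∑-∑< (splits δ) n (λ ab k → F (dropZeros (proj₁ ab)) * G k (dropZeros (proj₂ ab))))

∙-scaleʳ : ∀ F c G δ → (F ∙ (λ u → c * G u)) δ ≡ c * (F ∙ G) δ
∙-scaleʳ F c G δ =
  trans (∑-cong (splits δ) (λ ab → x*[y*z]≡y*[x*z] (F (dropZeros (proj₁ ab))) c (G (dropZeros (proj₂ ab)))))
        (sym (*-distribˡ-∑ (splits δ) c _))

∙-+ʳ : ∀ F G G' δ → (F ∙ (λ u → G u + G' u)) δ ≡ (F ∙ G) δ + (F ∙ G') δ
∙-+ʳ F G G' δ = trans (∑-cong (splits δ) (λ ab → ℚₚ.*-distribˡ-+ (F (dropZeros (proj₁ ab))) _ _)) (∑-+ (splits δ) _ _)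

∙-zeroʳ : ∀ F {G} → G ≐ 0Q → ∀ δ → (F ∙ G) δ ≡ 0ℚ
∙-zeroʳ F G≐0 δ = ∑-zero (splits δ) (λ ab →
  trans (cong (F (dropZeros (proj₁ ab)) *_) (at G≐0 (proj₂ ab))) (ℚₚ.*-zeroʳ (F (dropZeros (proj₁ ab)))))

∙-zeroˡ : ∀ G {F} → F ≐ 0Q → ∀ δ → (F ∙ G) δ ≡ 0ℚ
∙-zeroˡ G F≐0 δ = ∑-zero (splits δ) (λ ab →
  trans (cong (_* G (dropZeros (proj₂ ab))) (at F≐0 (proj₁ ab))) (ℚₚ.*-zeroˡ (G (dropZeros (proj₂ ab)))))

F∙Gg≡G∙Fg : ∀ δ F G g → (F ∙ (G ∙ g)) δ ≡ (G ∙ (F ∙ g)) δ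
F∙Gg≡G∙Fg []      F G g = x[yz+0]+0≡y[xz+0]+0 (F []) (G []) (g [])
  where
    x[yz+0]+0≡y[xz+0]+0 : ∀ x y z → x * (y * z + 0ℚ) + 0ℚ ≡ y * (x * z + 0ℚ) + 0ℚ
    x[yz+0]+0≡y[xz+0]+0 = solve-∀ ℚ-ring
F∙Gg≡G∙Fg (n ∷ δ) F G g = begin
    (F ∙ (G ∙ g)) (n ∷ δ)
  ≡⟨ ∙-∷ n δ F (G ∙ g) ⟩
    ∑< (suc n) (λ a → (H⊥ (+ a) F ∙ H⊥ (+ (n ∸ a)) (G ∙ g)) δ)
  ≡⟨ ∑<-cong (suc n) (λ a _ → trans (expand F G a) (∑<-cong (suc (n ∸ a)) (λ c _ →
       trans (F∙Gg≡G∙Fg δ (H⊥ (+ a) F) (H⊥ (+ c) G) (H⊥ (+ (n ∸ a ∸ c)) g))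
             (cong (λ k → (H⊥ (+ c) G ∙ (H⊥ (+ a) F ∙ H⊥ (+ k) g)) δ) (∸-swap a c))))) ⟩
    ∑< (suc n) (λ a → ∑< (suc (n ∸ a)) (λ c → (H⊥ (+ c) G ∙ (H⊥ (+ a) F ∙ H⊥ (+ (n ∸ c ∸ a)) g)) δ))
  ≡⟨ ∑<-triangle n (λ a c → (H⊥ (+ c) G ∙ (H⊥ (+ a) F ∙ H⊥ (+ (n ∸ c ∸ a)) g)) δ) ⟩
    ∑< (suc n) (λ c → ∑< (suc (n ∸ c)) (λ a → (H⊥ (+ c) G ∙ (H⊥ (+ a) F ∙ H⊥ (+ (n ∸ c ∸ a)) g)) δ))
  ≡⟨ ∑<-cong (suc n) (λ c _ → expand G F c) ⟨
    ∑< (suc n) (λ c → (H⊥ (+ c) G ∙ H⊥ (+ (n ∸ c)) (F ∙ g)) δ)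
  ≡⟨ ∙-∷ n δ G (F ∙ g) ⟨
    (G ∙ (F ∙ g)) (n ∷ δ) ∎
  where
    open ≡-Reasoning
    ∸-swap : ∀ a c → n ∸ a ∸ c ≡ n ∸ c ∸ a
    ∸-swap a c = trans (ℕₚ.∸-+-assoc n a c) (trans (cong (n ∸_) (ℕₚ.+-comm a c)) (sym (ℕₚ.∸-+-assoc n c a)))
    expand : ∀ F G a → (H⊥ (+ a) F ∙ H⊥ (+ (n ∸ a)) (G ∙ g)) δ ≡
             ∑< (suc (n ∸ a)) (λ c → (H⊥ (+ a) F ∙ (H⊥ (+ c) G ∙ H⊥ (+ (n ∸ a ∸ c)) g)) δ)
    expand F G a = trans (∙-congʳ (H⊥ (+ a) F) leibniz δ)
                         (∙-∑<ʳ (H⊥ (+ a) F) (suc (n ∸ a)) (λ c → H⊥ (+ c) G ∙ H⊥ (+ (n ∸ a ∸ c)) g) δ)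
      where
        leibniz : H⊥ (+ (n ∸ a)) (G ∙ g) ≐ λ u → ∑< (suc (n ∸ a)) (λ c → (H⊥ (+ c) G ∙ H⊥ (+ (n ∸ a ∸ c)) g) u)
        leibniz = pointwise (λ u → H⊥-∙ (n ∸ a) G g (dropZeros u))

∑-splits-cong : ∀ δ (φ ψ : List ℕ × List ℕ → ℚ) →
                (∀ a b → sum a ℕ.+ sum b ≡ sum δ → φ (a , b) ≡ ψ (a , b)) →
                ∑ (splits δ) φ ≡ ∑ (splits δ) ψ
∑-splits-cong []      φ ψ e = cong (_+ 0ℚ) (e [] [] refl)
∑-splits-cong (n ∷ δ) φ ψ e = begin
    ∑ (splits (n ∷ δ)) φ
  ≡⟨ ∑-concatMap (λ a → map (split a) (splits δ)) (upTo (suc n)) φ ⟩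
    ∑ (upTo (suc n)) (λ a → ∑ (map (split a) (splits δ)) φ)
  ≡⟨ ∑-upTo (suc n) (λ a → ∑ (map (split a) (splits δ)) φ) ⟩
    ∑< (suc n) (λ a → ∑ (map (split a) (splits δ)) φ)
  ≡⟨ ∑<-cong (suc n) (λ a a≤n → trans (∑-map (split a) (splits δ) φ) (trans
       (∑-splits-cong δ (φ ∘ split a) (ψ ∘ split a) (λ x y eq →
          e (a ∷ x) ((n ∸ a) ∷ y) (sum-split x y (ℕₚ.≤-pred a≤n) eq)))
       (sym (∑-map (split a) (splits δ) ψ)))) ⟩
    ∑< (suc n) (λ a → ∑ (map (split a) (splits δ)) ψ)
  ≡⟨ ∑-upTo (suc n) (λ a → ∑ (map (split a) (splits δ)) ψ) ⟨
    ∑ (upTo (suc n)) (λ a → ∑ (map (split a) (splits δ)) ψ)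
  ≡⟨ ∑-concatMap (λ a → map (split a) (splits δ)) (upTo (suc n)) ψ ⟨
    ∑ (splits (n ∷ δ)) ψ ∎
  where
    open ≡-Reasoning
    split : ℕ → List ℕ × List ℕ → List ℕ × List ℕ
    split a ab = (a ∷ proj₁ ab , (n ∸ a) ∷ proj₂ ab)
    sum-split : ∀ {a} x y → a ≤ n → sum x ℕ.+ sum y ≡ sum δ →
                (a ℕ.+ sum x) ℕ.+ ((n ∸ a) ℕ.+ sum y) ≡ n ℕ.+ sum δ
    sum-split {a} x y a≤n eq = begin
        (a ℕ.+ sum x) ℕ.+ ((n ∸ a) ℕ.+ sum y)
      ≡⟨ ℕ-+-interchange a (sum x) (n ∸ a) (sum y) ⟩
        (a ℕ.+ (n ∸ a)) ℕ.+ (sum x ℕ.+ sum y)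
      ≡⟨ cong₂ ℕ._+_ (ℕₚ.m+[n∸m]≡n a≤n) eq ⟩
        n ℕ.+ sum δ ∎

∙-congʳ-≤ : ∀ F {G G'} δ → (∀ u → sum u ≤ sum δ → G (dropZeros u) ≡ G' (dropZeros u)) →
            (F ∙ G) δ ≡ (F ∙ G') δ
∙-congʳ-≤ F δ e = ∑-splits-cong δ _ _ (λ a b eq →
  cong (F (dropZeros a) *_) (e b (subst (sum b ≤_) eq (ℕₚ.m≤n+m (sum b) (sum a)))))

F1-≢ : ∀ i γ → sum γ ≢ i → F1 i γ ≡ 0ℚ
F1-≢ i γ ≢i = cong 𝟙
  (dec-false (≡-dec ℕ._≟_ γ (replicate i 1)) (λ γ≡1ⁱ → ≢i (trans (cong sum γ≡1ⁱ) (sum-replicate-1 i))))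

F1∙-below : ∀ i G δ → sum δ < i → (F1 i ∙ G) δ ≡ 0ℚ
F1∙-below i G δ δ<i = trans (∑-splits-cong δ _ (λ _ → 0ℚ) (λ a b eq →
    trans (cong (_* G (dropZeros b)) (F1-≢ i (dropZeros a) (λ a≡i → ℕₚ.<⇒≱ δ<i (begin
        i                  ≡⟨ trans (sym (sum-dropZeros a)) a≡i ⟨
        sum a              ≤⟨ ℕₚ.m≤m+n (sum a) (sum b) ⟩
        sum a ℕ.+ sum b    ≡⟨ eq ⟩
        sum δ ∎))))
      (ℚₚ.*-zeroˡ (G (dropZeros b)))))
  (∑-zero (splits δ) (λ _ → refl))
  where open ℕₚ.≤-Reasoning

Fr-dropZeros : ∀ r u → Fr r (dropZeros u) ≡ 𝟙 (does (sum u ℕ.≟ r))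
Fr-dropZeros r u rewrite allPositive-dropZeros u | sum-dropZeros u = refl

H⊥-Fr : ∀ {a r} → a ≤ r → H⊥ (+ a) (Fr r) ≐ Fr (r ∸ a)
H⊥-Fr {a} {r} a≤r = pointwise at-u
  where
    at-u : ∀ u → Fr r (dropZeros (a ∷ dropZeros u)) ≡ Fr (r ∸ a) (dropZeros u)
    at-u u rewrite Fr-dropZeros r (a ∷ dropZeros u) | Fr-dropZeros (r ∸ a) u | sum-dropZeros u =
      cong 𝟙 (does-⇔ (mk⇔ (λ a+s≡r → trans (sym (ℕₚ.m+n∸m≡n a _)) (cong (_∸ a) a+s≡r))
                          (λ s≡r∸a → trans (cong (a ℕ.+_) s≡r∸a) (ℕₚ.m+[n∸m]≡n a≤r)))
                     (a ℕ.+ sum u ℕ.≟ r) (sum u ℕ.≟ r ∸ a))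

H⊥-Fr-over : ∀ {a r} → r < a → H⊥ (+ a) (Fr r) ≐ 0Q
H⊥-Fr-over {a} {r} r<a = pointwise at-u
  where
    at-u : ∀ u → Fr r (dropZeros (a ∷ dropZeros u)) ≡ 0ℚ
    at-u u rewrite Fr-dropZeros r (a ∷ dropZeros u) | sum-dropZeros u =
      cong 𝟙 (dec-false (a ℕ.+ sum u ℕ.≟ r) (λ a+s≡r → ℕₚ.<⇒≱ r<a (subst (a ≤_) a+s≡r (ℕₚ.m≤m+n a (sum u)))))

H⊥-F1-one : ∀ j → H⊥ (+ 1) (F1 (suc j)) ≐ F1 j
H⊥-F1-one j = pointwise at-u
  where
    at-u : ∀ u → F1 (suc j) (1 ∷ dropZeros (dropZeros u)) ≡ F1 j (dropZeros u)
    at-u u rewrite dropZeros-idem u =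
      cong 𝟙 (does-⇔ (mk⇔ ∷-injectiveʳ (cong (1 ∷_)))
                     (≡-dec ℕ._≟_ (1 ∷ dropZeros u) (replicate (suc j) 1)) (≡-dec ℕ._≟_ (dropZeros u) (replicate j 1)))

H⊥-F1-many : ∀ a j → H⊥ (+ suc (suc a)) (F1 j) ≐ 0Q
H⊥-F1-many a j = pointwise (λ u → cong 𝟙 (dec-false (≡-dec ℕ._≟_ _ (replicate j 1)) (≢1ʲ j)))
  where
    ≢1ʲ : ∀ {w} j → suc (suc a) ∷ w ≢ replicate j 1
    ≢1ʲ zero    ()
    ≢1ʲ (suc j) ()

H⊥-neg : ∀ {z} G → z ℤ.< + 0 → H⊥ z G ≐ 0Q
H⊥-neg {+ n}      G (ℤ.+<+ ())
H⊥-neg { -[1+ _ ]} G _ = pointwise (λ _ → refl)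

+m-+n≡+[m∸n] : ∀ {m n} → n ≤ m → + m ℤ.- + n ≡ + (m ∸ n)
+m-+n≡+[m∸n] {m} {n} n≤m = trans (ℤₚ.m-n≡m⊖n m n) (ℤₚ.⊖-≥ n≤m)

i+[j-i]≡j : ∀ i j → i ℤ.+ (j ℤ.- i) ≡ j
i+[j-i]≡j = ℤ-solve-∀

[j-i]+i≡j : ∀ i j → (j ℤ.- i) ℤ.+ i ≡ j
[j-i]+i≡j = ℤ-solve-∀

[i+j]-i≡j : ∀ i j → (i ℤ.+ j) ℤ.- i ≡ j
[i+j]-i≡j = ℤ-solve-∀

i<j⇒i-j<0 : ∀ {i j} → i ℤ.< j → i ℤ.- j ℤ.< + 0
i<j⇒i-j<0 {i} {j} i<j = subst (i ℤ.- j ℤ.<_) (ℤₚ.+-inverseʳ j) (ℤₚ.+-monoˡ-< (ℤ.- j) i<j)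

H⊥-Fr∙ : ∀ k r G u → H⊥ k (Fr r ∙ G) u ≡ ∑< (suc r) (λ j → (Fr (r ∸ j) ∙ H⊥ (k ℤ.- + j) G) u)
H⊥-Fr∙ -[1+ k ] r G u = sym (∑<-zero (suc r) (λ j _ →
  ∙-zeroʳ (Fr (r ∸ j)) (H⊥-neg G (i<j⇒i-j<0 { -[1+ k ]} {+ j} ℤ.-<+)) u))
H⊥-Fr∙ (+ n) r G u = trans (H⊥-∙ n (Fr r) G u) (∑<-match (suc n) (suc r) _ _ agree over-r over-n)
  where
    agree : ∀ j → j < suc n → j < suc r →
            (H⊥ (+ j) (Fr r) ∙ H⊥ (+ (n ∸ j)) G) u ≡ (Fr (r ∸ j) ∙ H⊥ (+ n ℤ.- + j) G) u
    agree j j≤n j≤r = ∙-cong (H⊥-Fr (ℕₚ.≤-pred j≤r))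
      (≐-reflexive (cong (λ i → H⊥ i G) (sym (+m-+n≡+[m∸n] (ℕₚ.≤-pred j≤n))))) u
    over-r : ∀ j → suc r ≤ j → j < suc n → (H⊥ (+ j) (Fr r) ∙ H⊥ (+ (n ∸ j)) G) u ≡ 0ℚ
    over-r j r<j _ = ∙-zeroˡ (H⊥ (+ (n ∸ j)) G) (H⊥-Fr-over r<j) u
    over-n : ∀ j → suc n ≤ j → j < suc r → (Fr (r ∸ j) ∙ H⊥ (+ n ℤ.- + j) G) u ≡ 0ℚ
    over-n j n<j _ = ∙-zeroʳ (Fr (r ∸ j)) (H⊥-neg G (i<j⇒i-j<0 (ℤ.+<+ n<j))) u

H⊥-F1∙ : ∀ k j G u → H⊥ k (F1 (suc j) ∙ G) u ≡ (F1 (suc j) ∙ H⊥ k G) u + (F1 j ∙ H⊥ (k ℤ.- + 1) G) u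
H⊥-F1∙ -[1+ k ] j G u = sym (trans
  (cong₂ _+_ (∙-zeroʳ (F1 (suc j)) (H⊥-neg { -[1+ k ]} G ℤ.-<+) u)
             (∙-zeroʳ (F1 j) (H⊥-neg { -[1+ k ] ℤ.- + 1} G ℤ.-<+) u))
  (ℚₚ.+-identityˡ 0ℚ))
H⊥-F1∙ (+ zero) j G u = trans (H⊥-∙ 0 (F1 (suc j)) G u) (cong₂ _+_
  (∙-congˡ (H⊥-zero (F1 (suc j))) (H⊥ (+ 0) G) u)
  (sym (∙-zeroʳ (F1 j) (H⊥-neg { + 0 ℤ.- + 1} G ℤ.-<+) u)))
H⊥-F1∙ (+ suc n) j G u = begin
    H⊥ (+ suc n) (F1 (suc j) ∙ G) u
  ≡⟨ H⊥-∙ (suc n) (F1 (suc j)) G u ⟩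
    (H⊥ (+ 0) (F1 (suc j)) ∙ H⊥ (+ suc n) G) u + ((H⊥ (+ 1) (F1 (suc j)) ∙ H⊥ (+ n) G) u + ∑< n higher)
  ≡⟨ cong₂ _+_ (∙-congˡ (H⊥-zero (F1 (suc j))) (H⊥ (+ suc n) G) u)
               (cong₂ _+_ (∙-congˡ (H⊥-F1-one j) (H⊥ (+ n) G) u)
                          (∑<-zero n (λ a _ → ∙-zeroˡ (H⊥ (+ (n ∸ suc a)) G) (H⊥-F1-many a (suc j)) u))) ⟩
    (F1 (suc j) ∙ H⊥ (+ suc n) G) u + ((F1 j ∙ H⊥ (+ n) G) u + 0ℚ)
  ≡⟨ cong (_+_ ((F1 (suc j) ∙ H⊥ (+ suc n) G) u)) (ℚₚ.+-identityʳ _) ⟩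
    (F1 (suc j) ∙ H⊥ (+ suc n) G) u + (F1 j ∙ H⊥ (+ n) G) u ∎
  where
    open ≡-Reasoning
    higher : ℕ → ℚ
    higher a = (H⊥ (+ suc (suc a)) (F1 (suc j)) ∙ H⊥ (+ (n ∸ suc a)) G) u

⟨_,_⟩ : NSym → QSymM → ℚ
⟨ x , G ⟩ = ∑ x (λ t → proj₁ t * G (dropZeros (proj₂ t)))

M : List ℕ → QSymM
M γ δ = 𝟙 (does (≡-dec ℕ._≟_ δ γ))

coeff-⟨⟩ : ∀ x γ → coeff x γ ≡ ⟨ x , M γ ⟩
coeff-⟨⟩ []            γ = refl
coeff-⟨⟩ ((c , w) ∷ x) γ = cong₂ _+_ (if-c≡c*𝟙 (does (≡-dec ℕ._≟_ (dropZeros w) γ))) (coeff-⟨⟩ x γ)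
  where
    if-c≡c*𝟙 : ∀ b → (if b then c else 0ℚ) ≡ c * 𝟙 b
    if-c≡c*𝟙 true  = sym (ℚₚ.*-identityʳ c)
    if-c≡c*𝟙 false = sym (ℚₚ.*-zeroʳ c)

⟨⟩-cong : ∀ x {G G'} → G ≐ G' → ⟨ x , G ⟩ ≡ ⟨ x , G' ⟩
⟨⟩-cong x G≐G' = ∑-cong x (λ t → cong (proj₁ t *_) (at G≐G' (proj₂ t)))

⟨⟩-cong-≤ : ∀ x {W G G'} → weight x ≤ W → (∀ u → sum u ≤ W → G (dropZeros u) ≡ G' (dropZeros u)) →
            ⟨ x , G ⟩ ≡ ⟨ x , G' ⟩
⟨⟩-cong-≤ []      x≤W e = refl
⟨⟩-cong-≤ (t ∷ x) {G = G} {G'} x≤W e = cong₂ _+_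
  (cong (proj₁ t *_) (e (proj₂ t) (ℕₚ.m+n≤o⇒m≤o (sum (proj₂ t)) x≤W)))
  (⟨⟩-cong-≤ x {G = G} {G'} (ℕₚ.m+n≤o⇒n≤o (sum (proj₂ t)) x≤W) e)

⟨⟩-∑<ʳ : ∀ x n (G : ℕ → QSymM) → ⟨ x , (λ u → ∑< n (λ k → G k u)) ⟩ ≡ ∑< n (λ k → ⟨ x , G k ⟩)
⟨⟩-∑<ʳ x n G = trans (∑-cong x (λ t → *-distribˡ-∑< n (proj₁ t) (λ k → G k (dropZeros (proj₂ t)))))
                     (∑-∑< x n (λ t k → proj₁ t * G k (dropZeros (proj₂ t))))

⟨⟩-scaleʳ : ∀ x c G → ⟨ x , (λ u → c * G u) ⟩ ≡ c * ⟨ x , G ⟩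
⟨⟩-scaleʳ x c G = trans (∑-cong x (λ t → x*[y*z]≡y*[x*z] (proj₁ t) c (G (dropZeros (proj₂ t)))))
                        (sym (*-distribˡ-∑ x c _))

⟨⟩-+ʳ : ∀ x G G' → ⟨ x , (λ u → G u + G' u) ⟩ ≡ ⟨ x , G ⟩ + ⟨ x , G' ⟩
⟨⟩-+ʳ x G G' = trans (∑-cong x (λ t → ℚₚ.*-distribˡ-+ (proj₁ t) _ _)) (∑-+ x _ _)

⟨⟩-zeroʳ : ∀ x {G} → G ≐ 0Q → ⟨ x , G ⟩ ≡ 0ℚ
⟨⟩-zeroʳ x G≐0 = ∑-zero x (λ t → trans (cong (proj₁ t *_) (at G≐0 (proj₂ t))) (ℚₚ.*-zeroʳ (proj₁ t)))

⟨⟩-sumN : ∀ xs G → ⟨ sumN xs , G ⟩ ≡ ∑ xs (λ x → ⟨ x , G ⟩)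
⟨⟩-sumN xs G = ∑-concat xs _

⟨⟩-oneN : ∀ G → ⟨ oneN , G ⟩ ≡ G []
⟨⟩-oneN G = trans (ℚₚ.+-identityʳ _) (ℚₚ.*-identityˡ (G []))

⟨⟩-scaleˡ : ∀ c x G → ⟨ scale c x , G ⟩ ≡ c * ⟨ x , G ⟩
⟨⟩-scaleˡ c x G =
  trans (∑-map _ x _) (trans (∑-cong x (λ t → ℚₚ.*-assoc c (proj₁ t) _)) (sym (*-distribˡ-∑ x c _)))

⟨⟩-hMul : ∀ k x G → ⟨ hMul k x , G ⟩ ≡ ⟨ x , H⊥ k G ⟩
⟨⟩-hMul (+ k)    x G = trans (∑-map _ x _) (∑-cong x (λ t → cong (λ w → proj₁ t * G w) (sym (dropZeros-∷ k (proj₂ t)))))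
⟨⟩-hMul -[1+ k ] x G = sym (⟨⟩-zeroʳ x (H⊥-neg { -[1+ k ]} G ℤ.-<+))

⟨⟩-perp : ∀ F x G → ⟨ perp F x , G ⟩ ≡ ⟨ x , F ∙ G ⟩
⟨⟩-perp F x G = trans (∑-concatMap _ x _) (∑-cong x (λ t → begin
    ∑ (map (λ ab → (proj₁ t * F (dropZeros (proj₁ ab)) , proj₂ ab)) (splits (proj₂ t)))
      (λ s → proj₁ s * G (dropZeros (proj₂ s)))
  ≡⟨ ∑-map _ (splits (proj₂ t)) _ ⟩
    ∑ (splits (proj₂ t)) (λ ab → proj₁ t * F (dropZeros (proj₁ ab)) * G (dropZeros (proj₂ ab)))
  ≡⟨ ∑-cong (splits (proj₂ t)) (λ ab → ℚₚ.*-assoc (proj₁ t) _ _) ⟩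
    ∑ (splits (proj₂ t)) (λ ab → proj₁ t * (F (dropZeros (proj₁ ab)) * G (dropZeros (proj₂ ab))))
  ≡⟨ *-distribˡ-∑ (splits (proj₂ t)) (proj₁ t) _ ⟨
    proj₁ t * (F ∙ G) (proj₂ t)
  ≡⟨ cong (proj₁ t *_) (∙-dropZeros (proj₂ t) F G) ⟨
    proj₁ t * (F ∙ G) (dropZeros (proj₂ t)) ∎))
  where open ≡-Reasoning

-- The adjoint of 𝔹_m

-- 𝔹ᵀ≤ N truncates the series at i ≤ N; as F_{1^i} ∙ _ vanishes in degrees below i, N = |δ| loses nothing.
𝔹ᵀ≤ : ℕ → ℤ → QSymM → QSymM
𝔹ᵀ≤ N m G δ = ∑< (suc N) (λ i → sgn i * (F1 i ∙ H⊥ (m ℤ.+ + i) G) δ)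

𝔹ᵀ : ℤ → QSymM → QSymM
𝔹ᵀ m G δ = 𝔹ᵀ≤ (sum δ) m G δ

𝔹ᵀ≤-stable : ∀ {N} m G δ → sum δ ≤ N → 𝔹ᵀ≤ N m G δ ≡ 𝔹ᵀ m G δ
𝔹ᵀ≤-stable m G δ δ≤N = ∑<-truncate _ (s≤s δ≤N) (λ i δ<i _ →
  trans (cong (sgn i *_) (F1∙-below i (H⊥ (m ℤ.+ + i) G) δ δ<i)) (ℚₚ.*-zeroʳ (sgn i)))

⟨𝔹⟩≤ : ∀ m x G → ⟨ 𝔹 m x , G ⟩ ≡ ⟨ x , 𝔹ᵀ≤ (weight x) m G ⟩
⟨𝔹⟩≤ m x G = begin
    ⟨ 𝔹 m x , G ⟩
  ≡⟨ ⟨⟩-sumN (map term (upTo (suc (weight x)))) G ⟩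
    ∑ (map term (upTo (suc (weight x)))) (λ y → ⟨ y , G ⟩)
  ≡⟨ ∑-map term (upTo (suc (weight x))) (λ y → ⟨ y , G ⟩) ⟩
    ∑ (upTo (suc (weight x))) (λ i → ⟨ term i , G ⟩)
  ≡⟨ ∑-upTo (suc (weight x)) (λ i → ⟨ term i , G ⟩) ⟩
    ∑< (suc (weight x)) (λ i → ⟨ term i , G ⟩)
  ≡⟨ ∑<-cong (suc (weight x)) (λ i _ → begin
       ⟨ term i , G ⟩
     ≡⟨ ⟨⟩-scaleˡ (sgn i) (hMul (m ℤ.+ + i) (perp (F1 i) x)) G ⟩
       sgn i * ⟨ hMul (m ℤ.+ + i) (perp (F1 i) x) , G ⟩
     ≡⟨ cong (sgn i *_) (trans (⟨⟩-hMul (m ℤ.+ + i) (perp (F1 i) x) G) (⟨⟩-perp (F1 i) x (H⊥ (m ℤ.+ + i) G))) ⟩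
       sgn i * ⟨ x , F1 i ∙ H⊥ (m ℤ.+ + i) G ⟩
     ≡⟨ ⟨⟩-scaleʳ x (sgn i) (F1 i ∙ H⊥ (m ℤ.+ + i) G) ⟨
       ⟨ x , (λ δ → sgn i * (F1 i ∙ H⊥ (m ℤ.+ + i) G) δ) ⟩ ∎) ⟩
    ∑< (suc (weight x)) (λ i → ⟨ x , (λ δ → sgn i * (F1 i ∙ H⊥ (m ℤ.+ + i) G) δ) ⟩)
  ≡⟨ ⟨⟩-∑<ʳ x (suc (weight x)) (λ i δ → sgn i * (F1 i ∙ H⊥ (m ℤ.+ + i) G) δ) ⟨
    ⟨ x , 𝔹ᵀ≤ (weight x) m G ⟩ ∎
  where
    open ≡-Reasoning
    term : ℕ → NSym
    term i = scale (sgn i) (hMul (m ℤ.+ + i) (perp (F1 i) x))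

⟨𝔹⟩ : ∀ m x G → ⟨ 𝔹 m x , G ⟩ ≡ ⟨ x , 𝔹ᵀ m G ⟩
⟨𝔹⟩ m x G = trans (⟨𝔹⟩≤ m x G) (⟨⟩-cong-≤ x {G = 𝔹ᵀ≤ (weight x) m G} {𝔹ᵀ m G} ℕₚ.≤-refl (λ u u≤x →
  𝔹ᵀ≤-stable m G (dropZeros u) (subst (_≤ weight x) (sym (sum-dropZeros u)) u≤x)))

∙-𝔹ᵀ≤ : ∀ F N m G δ → (F ∙ 𝔹ᵀ≤ N m G) δ ≡ ∑< (suc N) (λ i → sgn i * (F ∙ (F1 i ∙ H⊥ (m ℤ.+ + i) G)) δ)
∙-𝔹ᵀ≤ F N m G δ = trans (∙-∑<ʳ F (suc N) (λ i u → sgn i * (F1 i ∙ H⊥ (m ℤ.+ + i) G) u) δ)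
  (∑<-cong (suc N) (λ i _ → ∙-scaleʳ F (sgn i) (F1 i ∙ H⊥ (m ℤ.+ + i) G) δ))

∙-𝔹ᵀ≤-stable : ∀ F m G δ → (F ∙ 𝔹ᵀ≤ (sum δ) m G) δ ≡ (F ∙ 𝔹ᵀ m G) δ
∙-𝔹ᵀ≤-stable F m G δ = ∙-congʳ-≤ F {𝔹ᵀ≤ (sum δ) m G} {𝔹ᵀ m G} δ (λ u u≤δ →
  𝔹ᵀ≤-stable m G (dropZeros u) (subst (_≤ sum δ) (sym (sum-dropZeros u)) u≤δ))

[m+i]-j≡[m-j]+i : ∀ m i j → (m ℤ.+ i) ℤ.- j ≡ (m ℤ.- j) ℤ.+ i
[m+i]-j≡[m-j]+i = ℤ-solve-∀

𝔹ᵀ≤-Fr∙ : ∀ N m r G δ → 𝔹ᵀ≤ N m (Fr r ∙ G) δ ≡ ∑< (suc r) (λ j → (Fr (r ∸ j) ∙ 𝔹ᵀ≤ N (m ℤ.- + j) G) δ)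
𝔹ᵀ≤-Fr∙ N m r G δ = begin
    ∑< (suc N) (λ i → sgn i * (F1 i ∙ H⊥ (m ℤ.+ + i) (Fr r ∙ G)) δ)
  ≡⟨ ∑<-cong (suc N) (λ i _ → trans (cong (sgn i *_) (commute i)) (*-distribˡ-∑< (suc r) (sgn i) (X i))) ⟩
    ∑< (suc N) (λ i → ∑< (suc r) (λ j → sgn i * X i j))
  ≡⟨ ∑<-swap (suc N) (suc r) (λ i j → sgn i * X i j) ⟩
    ∑< (suc r) (λ j → ∑< (suc N) (λ i → sgn i * X i j))
  ≡⟨ ∑<-cong (suc r) (λ j _ → ∙-𝔹ᵀ≤ (Fr (r ∸ j)) N (m ℤ.- + j) G δ) ⟨
    ∑< (suc r) (λ j → (Fr (r ∸ j) ∙ 𝔹ᵀ≤ N (m ℤ.- + j) G) δ) ∎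
  where
    open ≡-Reasoning
    X : ℕ → ℕ → ℚ
    X i j = (Fr (r ∸ j) ∙ (F1 i ∙ H⊥ ((m ℤ.- + j) ℤ.+ + i) G)) δ
    leibniz : ∀ i → H⊥ (m ℤ.+ + i) (Fr r ∙ G) ≐ λ u → ∑< (suc r) (λ j → (Fr (r ∸ j) ∙ H⊥ ((m ℤ.+ + i) ℤ.- + j) G) u)
    leibniz i = pointwise (λ u → H⊥-Fr∙ (m ℤ.+ + i) r G (dropZeros u))
    commute : ∀ i → (F1 i ∙ H⊥ (m ℤ.+ + i) (Fr r ∙ G)) δ ≡ ∑< (suc r) (X i)
    commute i = trans (∙-congʳ (F1 i) (leibniz i) δ)
      (trans (∙-∑<ʳ (F1 i) (suc r) (λ j → Fr (r ∸ j) ∙ H⊥ ((m ℤ.+ + i) ℤ.- + j) G) δ)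
             (∑<-cong (suc r) (λ j _ → trans (F∙Gg≡G∙Fg δ (F1 i) (Fr (r ∸ j)) (H⊥ ((m ℤ.+ + i) ℤ.- + j) G))
                (cong (λ k → (Fr (r ∸ j) ∙ (F1 i ∙ H⊥ k G)) δ) ([m+i]-j≡[m-j]+i m (+ i) (+ j))))))

𝔹ᵀ≤-F1∙ : ∀ N m j G δ →
          𝔹ᵀ≤ N m (F1 (suc j) ∙ G) δ ≡ (F1 (suc j) ∙ 𝔹ᵀ≤ N m G) δ + (F1 j ∙ 𝔹ᵀ≤ N (m ℤ.- + 1) G) δ
𝔹ᵀ≤-F1∙ N m j G δ = begin
    ∑< (suc N) (λ i → sgn i * (F1 i ∙ H⊥ (m ℤ.+ + i) (F1 (suc j) ∙ G)) δ)
  ≡⟨ ∑<-cong (suc N) (λ i _ → trans (cong (sgn i *_) (commute i)) (ℚₚ.*-distribˡ-+ (sgn i) (X i) (Y i))) ⟩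
    ∑< (suc N) (λ i → sgn i * X i + sgn i * Y i)
  ≡⟨ ∑<-+ (suc N) (λ i → sgn i * X i) (λ i → sgn i * Y i) ⟩
    ∑< (suc N) (λ i → sgn i * X i) + ∑< (suc N) (λ i → sgn i * Y i)
  ≡⟨ cong₂ _+_ (∙-𝔹ᵀ≤ (F1 (suc j)) N m G δ) (∙-𝔹ᵀ≤ (F1 j) N (m ℤ.- + 1) G δ) ⟨
    (F1 (suc j) ∙ 𝔹ᵀ≤ N m G) δ + (F1 j ∙ 𝔹ᵀ≤ N (m ℤ.- + 1) G) δ ∎
  where
    open ≡-Reasoning
    X Y : ℕ → ℚ
    X i = (F1 (suc j) ∙ (F1 i ∙ H⊥ (m ℤ.+ + i) G)) δ
    Y i = (F1 j ∙ (F1 i ∙ H⊥ ((m ℤ.- + 1) ℤ.+ + i) G)) δ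
    leibniz : ∀ i → H⊥ (m ℤ.+ + i) (F1 (suc j) ∙ G) ≐
                    λ u → (F1 (suc j) ∙ H⊥ (m ℤ.+ + i) G) u + (F1 j ∙ H⊥ ((m ℤ.+ + i) ℤ.- + 1) G) u
    leibniz i = pointwise (λ u → H⊥-F1∙ (m ℤ.+ + i) j G (dropZeros u))
    commute : ∀ i → (F1 i ∙ H⊥ (m ℤ.+ + i) (F1 (suc j) ∙ G)) δ ≡ X i + Y i
    commute i = trans (∙-congʳ (F1 i) (leibniz i) δ)
      (trans (∙-+ʳ (F1 i) (F1 (suc j) ∙ H⊥ (m ℤ.+ + i) G) (F1 j ∙ H⊥ ((m ℤ.+ + i) ℤ.- + 1) G) δ)
             (cong₂ _+_ (F∙Gg≡G∙Fg δ (F1 i) (F1 (suc j)) (H⊥ (m ℤ.+ + i) G))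
                        (trans (F∙Gg≡G∙Fg δ (F1 i) (F1 j) (H⊥ ((m ℤ.+ + i) ℤ.- + 1) G))
                               (cong (λ k → (F1 j ∙ (F1 i ∙ H⊥ k G)) δ) ([m+i]-j≡[m-j]+i m (+ i) (+ 1))))))

𝔹ᵀ-Fr∙ : ∀ m r G δ → 𝔹ᵀ m (Fr r ∙ G) δ ≡ ∑< (suc r) (λ j → (Fr (r ∸ j) ∙ 𝔹ᵀ (m ℤ.- + j) G) δ)
𝔹ᵀ-Fr∙ m r G δ = trans (𝔹ᵀ≤-Fr∙ (sum δ) m r G δ)
  (∑<-cong (suc r) (λ j _ → ∙-𝔹ᵀ≤-stable (Fr (r ∸ j)) (m ℤ.- + j) G δ))

𝔹ᵀ-F1∙ : ∀ m j G δ → 𝔹ᵀ m (F1 (suc j) ∙ G) δ ≡ (F1 (suc j) ∙ 𝔹ᵀ m G) δ + (F1 j ∙ 𝔹ᵀ (m ℤ.- + 1) G) δ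
𝔹ᵀ-F1∙ m j G δ = trans (𝔹ᵀ≤-F1∙ (sum δ) m j G δ)
  (cong₂ _+_ (∙-𝔹ᵀ≤-stable (F1 (suc j)) m G δ) (∙-𝔹ᵀ≤-stable (F1 j) (m ℤ.- + 1) G δ))

-- Vanishing of 𝔖

F1⊥𝔖≡0 : ∀ {n} (γ : Vec ℤ n) j G → n < j → ⟨ 𝔖 γ , F1 j ∙ G ⟩ ≡ 0ℚ
F1⊥𝔖≡0 Vec.[] j G 0<j = trans (⟨⟩-oneN (F1 j ∙ G)) (F1∙-below j G [] 0<j)
F1⊥𝔖≡0 (a ∷ γ) (suc j) G (s≤s n<j) = begin
    ⟨ 𝔹 a (𝔖 γ) , F1 (suc j) ∙ G ⟩
  ≡⟨ ⟨𝔹⟩ a (𝔖 γ) (F1 (suc j) ∙ G) ⟩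
    ⟨ 𝔖 γ , 𝔹ᵀ a (F1 (suc j) ∙ G) ⟩
  ≡⟨ ⟨⟩-cong (𝔖 γ) commute ⟩
    ⟨ 𝔖 γ , (λ δ → (F1 (suc j) ∙ 𝔹ᵀ a G) δ + (F1 j ∙ 𝔹ᵀ (a ℤ.- + 1) G) δ) ⟩
  ≡⟨ ⟨⟩-+ʳ (𝔖 γ) (F1 (suc j) ∙ 𝔹ᵀ a G) (F1 j ∙ 𝔹ᵀ (a ℤ.- + 1) G) ⟩
    ⟨ 𝔖 γ , F1 (suc j) ∙ 𝔹ᵀ a G ⟩ + ⟨ 𝔖 γ , F1 j ∙ 𝔹ᵀ (a ℤ.- + 1) G ⟩
  ≡⟨ cong₂ _+_ (F1⊥𝔖≡0 γ (suc j) (𝔹ᵀ a G) (ℕₚ.m<n⇒m<1+n n<j)) (F1⊥𝔖≡0 γ j (𝔹ᵀ (a ℤ.- + 1) G) n<j) ⟩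
    0ℚ + 0ℚ
  ≡⟨ ℚₚ.+-identityʳ 0ℚ ⟩
    0ℚ ∎
  where
    open ≡-Reasoning
    commute : 𝔹ᵀ a (F1 (suc j) ∙ G) ≐ λ δ → (F1 (suc j) ∙ 𝔹ᵀ a G) δ + (F1 j ∙ 𝔹ᵀ (a ℤ.- + 1) G) δ
    commute = pointwise (λ u → 𝔹ᵀ-F1∙ a j G (dropZeros u))

𝔖≡0 : ∀ {n} b (γ : Vec ℤ n) G → b ℤ.+ + n ℤ.< + 0 → ⟨ 𝔖 (b ∷ γ) , G ⟩ ≡ 0ℚ
𝔖≡0 {n} b γ G b+n<0 = begin
    ⟨ 𝔹 b (𝔖 γ) , G ⟩
  ≡⟨ ⟨𝔹⟩≤ b (𝔖 γ) G ⟩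
    ⟨ 𝔖 γ , 𝔹ᵀ≤ W b G ⟩
  ≡⟨ ⟨⟩-∑<ʳ (𝔖 γ) (suc W) (λ i δ → sgn i * (F1 i ∙ H⊥ (b ℤ.+ + i) G) δ) ⟩
    ∑< (suc W) (λ i → ⟨ 𝔖 γ , (λ δ → sgn i * (F1 i ∙ H⊥ (b ℤ.+ + i) G) δ) ⟩)
  ≡⟨ ∑<-zero (suc W) (λ i _ → trans (⟨⟩-scaleʳ (𝔖 γ) (sgn i) (F1 i ∙ H⊥ (b ℤ.+ + i) G))
                                    (trans (cong (sgn i *_) (term i)) (ℚₚ.*-zeroʳ (sgn i)))) ⟩
    0ℚ ∎
  where
    open ≡-Reasoning
    W = weight (𝔖 γ)
    term : ∀ i → ⟨ 𝔖 γ , F1 i ∙ H⊥ (b ℤ.+ + i) G ⟩ ≡ 0ℚ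
    term i with i ℕ.≤? n
    ... | yes i≤n = ⟨⟩-zeroʳ (𝔖 γ) {F1 i ∙ H⊥ (b ℤ.+ + i) G}
                      (pointwise (λ u → ∙-zeroʳ (F1 i) (H⊥-neg G b+i<0) (dropZeros u)))
      where
        b+i<0 : b ℤ.+ + i ℤ.< + 0
        b+i<0 = ℤₚ.≤-<-trans (ℤₚ.+-monoʳ-≤ b (ℤ.+≤+ i≤n)) b+n<0
    ... | no i≰n  = F1⊥𝔖≡0 γ i (H⊥ (b ℤ.+ + i) G) (ℕₚ.≰⇒> i≰n)

∑-rangeℤ : ∀ lo hi (F : ℤ → ℚ) N → (∀ b → b ℤ.< lo → F b ≡ 0ℚ) → (∀ j → N ≤ j → F (hi ℤ.- + j) ≡ 0ℚ) →
           ∑ (rangeℤ lo hi) F ≡ ∑< N (λ j → F (hi ℤ.- + j))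
∑-rangeℤ lo hi F N below-lo from-N with hi ℤ.- lo in hi-lo≡
... | + d = begin
    ∑ (map (λ k → lo ℤ.+ + k) (upTo (suc d))) F
  ≡⟨ ∑-map (λ k → lo ℤ.+ + k) (upTo (suc d)) F ⟩
    ∑ (upTo (suc d)) (λ k → F (lo ℤ.+ + k))
  ≡⟨ ∑-upTo (suc d) (λ k → F (lo ℤ.+ + k)) ⟩
    ∑< (suc d) (λ k → F (lo ℤ.+ + k))
  ≡⟨ ∑<-reverse (suc d) (λ k → F (lo ℤ.+ + k)) ⟩
    ∑< (suc d) (λ k → F (lo ℤ.+ + (d ∸ k)))
  ≡⟨ ∑<-cong (suc d) (λ k k≤d → cong F (reindex (ℕₚ.≤-pred k≤d))) ⟩
    ∑< (suc d) (λ k → F (hi ℤ.- + k))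
  ≡⟨ ∑<-match (suc d) N _ _ (λ _ _ _ → refl) (λ k N≤k _ → from-N k N≤k)
       (λ k d<k _ → below-lo (hi ℤ.- + k) (hi-k<lo (ℤ.+<+ d<k))) ⟩
    ∑< N (λ j → F (hi ℤ.- + j)) ∎
  where
    open ≡-Reasoning
    lo+[hi-lo-k]≡hi-k : ∀ lo hi k → lo ℤ.+ ((hi ℤ.- lo) ℤ.- k) ≡ hi ℤ.- k
    lo+[hi-lo-k]≡hi-k = ℤ-solve-∀
    reindex : ∀ {k} → k ≤ d → lo ℤ.+ + (d ∸ k) ≡ hi ℤ.- + k
    reindex {k} k≤d = trans (cong (ℤ._+_ lo) (trans (sym (+m-+n≡+[m∸n] k≤d)) (cong (ℤ._- + k) (sym hi-lo≡))))
                            (lo+[hi-lo-k]≡hi-k lo hi (+ k))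
    hi-k<lo : ∀ {k} → + d ℤ.< + k → hi ℤ.- + k ℤ.< lo
    hi-k<lo {k} d<k = subst₂ ℤ._<_ (lo+[hi-lo-k]≡hi-k lo hi (+ k)) (ℤₚ.+-identityʳ lo)
      (ℤₚ.+-monoʳ-< lo (subst (λ e → e ℤ.- + k ℤ.< + 0) (sym hi-lo≡) (i<j⇒i-j<0 d<k)))
... | -[1+ t ] = sym (∑<-zero N (λ j _ → below-lo (hi ℤ.- + j) (ℤₚ.≤-<-trans (ℤₚ.i-j≤i hi (+ j)) hi<lo)))
  where
    hi<lo : hi ℤ.< lo
    hi<lo = subst₂ ℤ._<_ ([j-i]+i≡j lo hi) (ℤₚ.+-identityˡ lo)
      (ℤₚ.+-monoˡ-< lo (subst (ℤ._< + 0) (sym hi-lo≡) ℤ.-<+))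

∑-rangeℤ-zero : ∀ lo hi (F : ℤ → ℚ) → (∀ b → b ℤ.≤ hi → F b ≡ 0ℚ) → ∑ (rangeℤ lo hi) F ≡ 0ℚ
∑-rangeℤ-zero lo hi F ≤hi with hi ℤ.- lo in hi-lo≡
... | + d = trans (∑-map (λ k → lo ℤ.+ + k) (upTo (suc d)) F)
  (trans (∑-upTo (suc d) (λ k → F (lo ℤ.+ + k))) (∑<-zero (suc d) (λ k k≤d → ≤hi _ (lo+k≤hi (ℕₚ.≤-pred k≤d)))))
  where
    lo+k≤hi : ∀ {k} → k ≤ d → lo ℤ.+ + k ℤ.≤ hi
    lo+k≤hi k≤d = subst (lo ℤ.+ _ ℤ.≤_) (trans (cong (ℤ._+_ lo) (sym hi-lo≡)) (i+[j-i]≡j lo hi))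
                        (ℤₚ.+-monoʳ-≤ lo (ℤ.+≤+ k≤d))
... | -[1+ _ ] = refl

∑-boxList-zero : ∀ {k} (bs : Vec (ℤ × ℤ) k) (f : Vec ℤ k → ℚ) →
                 (∀ β → sumℤ β ℤ.≤ sumℤ (Vec.map proj₂ bs) → f β ≡ 0ℚ) → ∑ (boxList bs) f ≡ 0ℚ
∑-boxList-zero Vec.[]             f ≤bs = trans (cong (_+ 0ℚ) (≤bs Vec.[] ℤₚ.≤-refl)) (ℚₚ.+-identityʳ 0ℚ)
∑-boxList-zero ((lo , hi) ∷ bs) f ≤bs = trans (∑-concatMap (λ b → map (b ∷_) (boxList bs)) (rangeℤ lo hi) f)
  (∑-rangeℤ-zero lo hi _ (λ b b≤hi → trans (∑-map (b ∷_) (boxList bs) f)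
    (∑-boxList-zero bs (λ β → f (b ∷ β)) (λ β β≤bs → ≤bs (b ∷ β) (ℤₚ.+-mono-≤ b≤hi β≤bs)))))

∑-box-zero : ∀ {m} (α : Vec ℤ m) (f : Vec ℤ m → ℚ) → (∀ β → sumℤ β ℤ.≤ sumℤ α → f β ≡ 0ℚ) → ∑ (box α) f ≡ 0ℚ
∑-box-zero {m} α f ≤α = ∑-boxList-zero bounds f (λ β β≤ → ≤α β (subst (λ v → sumℤ β ℤ.≤ sumℤ v) upper≡α β≤))
  where
    bounds : Vec (ℤ × ℤ) m
    bounds = Vec.tabulate (λ i → (+ suc (toℕ i) ℤ.- + m , Vec.lookup α i))
    upper≡α : Vec.map proj₂ bounds ≡ α
    upper≡α = trans (sym (tabulate-∘ proj₂ _)) (tabulate∘lookup α)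

box-∷ : ∀ {n} a (α : Vec ℤ n) → box (a ∷ α) ≡ concatMap (λ b → map (b ∷_) (box α)) (rangeℤ (+ 1 ℤ.- + suc n) a)
box-∷ {n} a α = cong (λ bs → concatMap (λ b → map (b ∷_) (boxList bs)) (rangeℤ (+ 1 ℤ.- + suc n) a))
  (tabulate-cong (λ i → cong (_, Vec.lookup α i) ([2+i]-[1+n]≡[1+i]-n (toℕ i))))
  where
    [2+i]-[1+n]≡[1+i]-n : ∀ i → + suc (suc i) ℤ.- + suc n ≡ + suc i ℤ.- + n
    [2+i]-[1+n]≡[1+i]-n i = trans (ℤₚ.m-n≡m⊖n (suc (suc i)) (suc n))
      (trans (ℤₚ.[1+m]⊖[1+n]≡m⊖n (suc i) n) (sym (ℤₚ.m-n≡m⊖n (suc i) n)))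

[a-j]+x<[a+s]-r : ∀ a {r j x s} → r < j → x ℤ.≤ s → (a ℤ.- + j) ℤ.+ x ℤ.< (a ℤ.+ s) ℤ.- + r
[a-j]+x<[a+s]-r a {r} {j} {x} {s} r<j x≤s = begin-strict
    (a ℤ.- + j) ℤ.+ x   ≤⟨ ℤₚ.+-monoʳ-≤ (a ℤ.- + j) x≤s ⟩
    (a ℤ.- + j) ℤ.+ s   <⟨ ℤₚ.+-monoˡ-< s (ℤₚ.+-monoʳ-< a (ℤₚ.neg-mono-< (ℤ.+<+ r<j))) ⟩
    (a ℤ.- + r) ℤ.+ s   ≡⟨ [a-r]+s≡[a+s]-r a (+ r) s ⟩
    (a ℤ.+ s) ℤ.- + r   ∎
  where
    open ℤₚ.≤-Reasoning
    [a-r]+s≡[a+s]-r : ∀ a r s → (a ℤ.- r) ℤ.+ s ≡ (a ℤ.+ s) ℤ.- r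
    [a-r]+s≡[a+s]-r = ℤ-solve-∀

x≡s-[r∸j]⇔[a-j]+x≡[a+s]-r : ∀ a {r j x s} → j ≤ r →
                             x ≡ s ℤ.- + (r ∸ j) ⇔ (a ℤ.- + j) ℤ.+ x ≡ (a ℤ.+ s) ℤ.- + r
x≡s-[r∸j]⇔[a-j]+x≡[a+s]-r a {r} {j} {x} {s} j≤r = mk⇔
  (λ eq → trans (cong (ℤ._+_ (a ℤ.- + j)) (trans eq target≡)) (i+[j-i]≡j (a ℤ.- + j) _))
  (λ eq → trans (sym ([i+j]-i≡j (a ℤ.- + j) x)) (trans (cong (ℤ._- (a ℤ.- + j)) eq) (sym target≡)))
  where
    s-[r-j]≡[a+s-r]-[a-j] : ∀ a s r j → s ℤ.- (r ℤ.- j) ≡ ((a ℤ.+ s) ℤ.- r) ℤ.- (a ℤ.- j)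
    s-[r-j]≡[a+s-r]-[a-j] = ℤ-solve-∀
    target≡ : s ℤ.- + (r ∸ j) ≡ ((a ℤ.+ s) ℤ.- + r) ℤ.- (a ℤ.- + j)
    target≡ = trans (cong (ℤ._-_ s) (sym (+m-+n≡+[m∸n] j≤r))) (s-[r-j]≡[a+s-r]-[a-j] a s (+ r) (+ j))

boxSlice : ∀ {m} → Vec ℤ m → ℕ → List (Vec ℤ m)
boxSlice α r = filter (λ β → sumℤ β ℤ.≟ (sumℤ α ℤ.- + r)) (box α)

∑-boxSlice-∷ : ∀ {n} a (α : Vec ℤ n) r (ψ : Vec ℤ (suc n) → ℚ) → (∀ b β → b ℤ.+ + n ℤ.< + 0 → ψ (b ∷ β) ≡ 0ℚ) →
               ∑ (boxSlice (a ∷ α) r) ψ ≡ ∑< (suc r) (λ j → ∑ (boxSlice α (r ∸ j)) (λ β → ψ ((a ℤ.- + j) ∷ β)))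
∑-boxSlice-∷ {n} a α r ψ ψ≡0 = begin
    ∑ (boxSlice (a ∷ α) r) ψ
  ≡⟨ ∑-filter (λ β → sumℤ β ℤ.≟ (a ℤ.+ s) ℤ.- + r) (box (a ∷ α)) ψ ⟩
    ∑ (box (a ∷ α)) χ
  ≡⟨ cong (λ βs → ∑ βs χ) (box-∷ a α) ⟩
    ∑ (concatMap (λ b → map (b ∷_) (box α)) (rangeℤ lo a)) χ
  ≡⟨ ∑-concatMap (λ b → map (b ∷_) (box α)) (rangeℤ lo a) χ ⟩
    ∑ (rangeℤ lo a) (λ b → ∑ (map (b ∷_) (box α)) χ)
  ≡⟨ ∑-cong (rangeℤ lo a) (λ b → ∑-map (b ∷_) (box α) χ) ⟩
    ∑ (rangeℤ lo a) column
  ≡⟨ ∑-rangeℤ lo a column (suc r) column-below column-over ⟩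
    ∑< (suc r) (λ j → column (a ℤ.- + j))
  ≡⟨ ∑<-cong (suc r) (λ j j≤r → column-slice (ℕₚ.≤-pred j≤r)) ⟩
    ∑< (suc r) (λ j → ∑ (boxSlice α (r ∸ j)) (λ β → ψ ((a ℤ.- + j) ∷ β))) ∎
  where
    open ≡-Reasoning
    s : ℤ
    s = sumℤ α
    lo : ℤ
    lo = + 1 ℤ.- + suc n
    χ : Vec ℤ (suc n) → ℚ
    χ β = if does (sumℤ β ℤ.≟ (a ℤ.+ s) ℤ.- + r) then ψ β else 0ℚ
    column : ℤ → ℚ
    column b = ∑ (box α) (λ β → χ (b ∷ β))

    [1-[1+n]]+n≡0 : ∀ n → (+ 1 ℤ.- (+ 1 ℤ.+ n)) ℤ.+ n ≡ + 0
    [1-[1+n]]+n≡0 = ℤ-solve-∀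
    column-below : ∀ b → b ℤ.< lo → column b ≡ 0ℚ
    column-below b b<lo = ∑-zero (box α) (λ β → if-zero _ (ψ≡0 b β
      (subst (b ℤ.+ + n ℤ.<_) ([1-[1+n]]+n≡0 (+ n)) (ℤₚ.+-monoˡ-< (+ n) b<lo))))

    column-over : ∀ j → suc r ≤ j → column (a ℤ.- + j) ≡ 0ℚ
    column-over j r<j = ∑-box-zero α _ (λ β β≤α → cong (λ t → if t then ψ ((a ℤ.- + j) ∷ β) else 0ℚ)
      (dec-false ((a ℤ.- + j) ℤ.+ sumℤ β ℤ.≟ (a ℤ.+ s) ℤ.- + r) (ℤₚ.<⇒≢ ([a-j]+x<[a+s]-r a r<j β≤α))))

    column-slice : ∀ {j} → j ≤ r → column (a ℤ.- + j) ≡ ∑ (boxSlice α (r ∸ j)) (λ β → ψ ((a ℤ.- + j) ∷ β))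
    column-slice {j} j≤r = sym (trans (∑-filter (λ β → sumℤ β ℤ.≟ s ℤ.- + (r ∸ j)) (box α) _)
      (∑-cong (box α) (λ β → cong (λ t → if t then ψ ((a ℤ.- + j) ∷ β) else 0ℚ)
        (does-⇔ (x≡s-[r∸j]⇔[a-j]+x≡[a+s]-r a j≤r)
                (sumℤ β ℤ.≟ s ℤ.- + (r ∸ j)) ((a ℤ.- + j) ℤ.+ sumℤ β ℤ.≟ (a ℤ.+ s) ℤ.- + r)))))

Fr⊥𝔖 : ∀ {m} (α : Vec ℤ m) r G → ⟨ 𝔖 α , Fr r ∙ G ⟩ ≡ ∑ (boxSlice α r) (λ β → ⟨ 𝔖 β , G ⟩)
Fr⊥𝔖 Vec.[] zero    G = 1*[1*y+0]+0≡[1*y+0]+0 (G [])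
  where
    1*[1*y+0]+0≡[1*y+0]+0 : ∀ y → 1ℚ * (1ℚ * y + 0ℚ) + 0ℚ ≡ (1ℚ * y + 0ℚ) + 0ℚ
    1*[1*y+0]+0≡[1*y+0]+0 = solve-∀ ℚ-ring
Fr⊥𝔖 Vec.[] (suc r) G = 1*[0*y+0]+0≡0 (G [])
  where
    1*[0*y+0]+0≡0 : ∀ y → 1ℚ * (0ℚ * y + 0ℚ) + 0ℚ ≡ 0ℚ
    1*[0*y+0]+0≡0 = solve-∀ ℚ-ring
Fr⊥𝔖 {suc n} (a ∷ α) r G = begin
    ⟨ 𝔹 a (𝔖 α) , Fr r ∙ G ⟩
  ≡⟨ ⟨𝔹⟩ a (𝔖 α) (Fr r ∙ G) ⟩
    ⟨ 𝔖 α , 𝔹ᵀ a (Fr r ∙ G) ⟩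
  ≡⟨ ⟨⟩-cong (𝔖 α) commute ⟩
    ⟨ 𝔖 α , (λ δ → ∑< (suc r) (λ j → (Fr (r ∸ j) ∙ 𝔹ᵀ (a ℤ.- + j) G) δ)) ⟩
  ≡⟨ ⟨⟩-∑<ʳ (𝔖 α) (suc r) (λ j → Fr (r ∸ j) ∙ 𝔹ᵀ (a ℤ.- + j) G) ⟩
    ∑< (suc r) (λ j → ⟨ 𝔖 α , Fr (r ∸ j) ∙ 𝔹ᵀ (a ℤ.- + j) G ⟩)
  ≡⟨ ∑<-cong (suc r) (λ j _ → trans (Fr⊥𝔖 α (r ∸ j) (𝔹ᵀ (a ℤ.- + j) G))
       (∑-cong (boxSlice α (r ∸ j)) (λ β → sym (⟨𝔹⟩ (a ℤ.- + j) (𝔖 β) G)))) ⟩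
    ∑< (suc r) (λ j → ∑ (boxSlice α (r ∸ j)) (λ β → ⟨ 𝔖 ((a ℤ.- + j) ∷ β) , G ⟩))
  ≡⟨ ∑-boxSlice-∷ a α r (λ β → ⟨ 𝔖 β , G ⟩) (λ b β → 𝔖≡0 b β G) ⟨
    ∑ (boxSlice (a ∷ α) r) (λ β → ⟨ 𝔖 β , G ⟩) ∎
  where
    open ≡-Reasoning
    commute : 𝔹ᵀ a (Fr r ∙ G) ≐ λ δ → ∑< (suc r) (λ j → (Fr (r ∸ j) ∙ 𝔹ᵀ (a ℤ.- + j) G) δ)
    commute = pointwise (λ u → 𝔹ᵀ-Fr∙ a r G (dropZeros u))

proposition3p35 : (m r : ℕ) (α : Vec ℤ m) →
    perp (Fr r) (𝔖 α) ≈
      sumN (map 𝔖 (filter (λ β → sumℤ β ℤ.≟ (sumℤ α ℤ.- + r)) (box α)))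
proposition3p35 m r α γ = begin
    coeff (perp (Fr r) (𝔖 α)) γ
  ≡⟨ coeff-⟨⟩ (perp (Fr r) (𝔖 α)) γ ⟩
    ⟨ perp (Fr r) (𝔖 α) , M γ ⟩
  ≡⟨ ⟨⟩-perp (Fr r) (𝔖 α) (M γ) ⟩
    ⟨ 𝔖 α , Fr r ∙ M γ ⟩
  ≡⟨ Fr⊥𝔖 α r (M γ) ⟩
    ∑ (boxSlice α r) (λ β → ⟨ 𝔖 β , M γ ⟩)
  ≡⟨ ∑-map 𝔖 (boxSlice α r) (λ x → ⟨ x , M γ ⟩) ⟨
    ∑ (map 𝔖 (boxSlice α r)) (λ x → ⟨ x , M γ ⟩)
  ≡⟨ ⟨⟩-sumN (map 𝔖 (boxSlice α r)) (M γ) ⟨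
    ⟨ sumN (map 𝔖 (boxSlice α r)) , M γ ⟩
  ≡⟨ coeff-⟨⟩ (sumN (map 𝔖 (boxSlice α r))) γ ⟨
    coeff (sumN (map 𝔖 (boxSlice α r))) γ ∎
  where open ≡-Reasoning
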